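{- Let $x$ be a binary word of length $n$ with $x[1] = 0$. For every $1 < i \le n$, if $x[i] = 1$ then $\pi_x[i] \le \pi_x[i-1]$.
   Context: For a binary word $w$ over $\{0,1\}$, $ones(w)$ denotes the number of $1$'s in $w$. Two binary words of equal length are abelian equivalent if they have the same number of $1$'s. An abelian border of a binary word $w$ is a proper prefix of $w$ (a prefix different from $w$, possibly empty) that is abelian equivalent to the proper suffix of $w$ of the same length. For a binary word $x$ of length $n$, the abelian border array $\pi_x$ is the array of length $n$ with $\pi_x[i]$ ($1\le i\le n$) equal to the length of the longest abelian border of the prefix $x[1\cdots i]$. -}

module Defs where

open import Data.Bool using (Bool; true; false; if_then_else_)
open import Data.Nat using (ℕ; zero; suc; _+_; _∸_; _<_; _≟_)
open import Data.List using (List; []; _∷_; length; take; drop)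
open import Relation.Nullary using (yes; no)
open import Data.Product using (_×_)
open import Relation.Binary.PropositionalEquality using (_≡_)

-- Binary words: lists of Bool, with false = 0 and true = 1.
Word : Set
Word = List Bool

ones : Word → ℕ
ones [] = 0
ones (true ∷ w) = suc (ones w)
ones (false ∷ w) = ones w

prefix : ℕ → Word → Word
prefix ℓ w = take ℓ w

suffix : ℕ → Word → Word
suffix ℓ w = drop (length w ∸ ℓ) w

-- ℓ is (the length of) an abelian border of w: a proper prefix of length ℓ
-- abelian equivalent to the suffix of length ℓ.
IsAbelianBorder : Word → ℕ → Set
IsAbelianBorder w ℓ = (ℓ < length w) × (ones (prefix ℓ w) ≡ ones (suffix ℓ w))

searchDown : Word → ℕ → ℕ
searchDown w zero = zero
searchDown w (suc k) with ones (prefix (suc k) w) ≟ ones (suffix (suc k) w)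
... | yes _ = suc k
... | no  _ = searchDown w k

-- length of the longest abelian border of w (0 for the empty word)
longestAbelianBorder : Word → ℕ
longestAbelianBorder w = searchDown w (length w ∸ 1)

-- the 1-indexed letter x[i] (default false out of range; only used in range)
letter : Word → ℕ → Bool
letter [] _ = false
letter (a ∷ w) zero = false
letter (a ∷ w) (suc zero) = a
letter (a ∷ w) (suc (suc i)) = letter w (suc i)

abelianBorderArray : Word → ℕ → ℕ
abelianBorderArray x i = longestAbelianBorder (prefix i x)

{-# OPTIONS --safe #-}
-- Write x[1..i] = z 1 with z = 0w, and let ℓ > 0 be the longest abelian border
-- of z 1. Its suffix ends in the new 1, so the prefix of z of length ℓ has one
-- more 1 than the suffix of z of length ℓ − 1, hence at least as many as the
-- suffix of length ℓ. This rules out ℓ = |z| (z and w have the same number of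
-- 1's), while at length |z| − 1 = |w| the suffix w of z holds every 1 of z.
-- The prefix count never decreases and the suffix count grows by at most one
-- per step, so the two counts meet at some length between ℓ and |w|: an
-- abelian border of z of length at least ℓ.
module Submission where

open import Defs
open import Data.Bool using (Bool; true; false)
open import Data.Nat using (ℕ; zero; suc; pred; _≤_; _<_; _∸_; _≟_; z≤n; s≤s)
open import Data.Nat.Properties
open import Data.List using ([]; _∷_; _∷ʳ_; length; take; drop)
open import Data.List.Properties using (length-++; take-all; drop-all)
open import Data.Product using (_×_; _,_; ∃-syntax)
open import Data.Sum using (_⊎_; inj₁; inj₂)
open import Data.Empty using (⊥-elim)
open import Relation.Nullary using (yes; no)
open import Relation.Binary.PropositionalEquality

discrete-ivt : (a b : ℕ → ℕ) → (∀ k → a k ≤ a (suc k)) → (∀ k → b (suc k) ≤ suc (b k)) →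
  ∀ {l m} → l ≤ m → b l ≤ a l → a m ≤ b m → ∃[ k ] l ≤ k × k ≤ m × a k ≡ b k
discrete-ivt a b a-mono b-step {m = zero} z≤n bl≤al am≤bm = 0 , z≤n , z≤n , ≤-antisym am≤bm bl≤al
discrete-ivt a b a-mono b-step {l} {suc m} l≤m bl≤al am≤bm with a (suc m) ≟ b (suc m)
... | yes eq = suc m , l≤m , ≤-refl , eq
... | no neq with m≤n⇒m<n∨m≡n l≤m
...   | inj₂ refl = ⊥-elim (neq (≤-antisym am≤bm bl≤al))
...   | inj₁ (s≤s l≤m′) =
  let k , l≤k , k≤m , eq = discrete-ivt a b a-mono b-step l≤m′ bl≤al am≤bm′
  in k , l≤k , m≤n⇒m≤1+n k≤m , eq
  where
  am≤bm′ : a m ≤ b m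
  am≤bm′ = ≤-pred (≤-<-trans (a-mono m) (<-≤-trans (≤∧≢⇒< am≤bm neq) (b-step m)))

ones-take-suc : ∀ k (w : Word) → ones (take k w) ≤ ones (take (suc k) w)
ones-take-suc zero [] = z≤n
ones-take-suc zero (a ∷ w) = z≤n
ones-take-suc (suc k) [] = z≤n
ones-take-suc (suc k) (true ∷ w) = s≤s (ones-take-suc k w)
ones-take-suc (suc k) (false ∷ w) = ones-take-suc k w

ones-take≤ones : ∀ k (w : Word) → ones (take k w) ≤ ones w
ones-take≤ones zero w = z≤n
ones-take≤ones (suc k) [] = z≤n
ones-take≤ones (suc k) (true ∷ w) = s≤s (ones-take≤ones k w)
ones-take≤ones (suc k) (false ∷ w) = ones-take≤ones k w

ones-drop-pred : ∀ j (w : Word) → ones (drop (pred j) w) ≤ suc (ones (drop j w))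
ones-drop-pred zero w = n≤1+n _
ones-drop-pred (suc zero) [] = z≤n
ones-drop-pred (suc zero) (true ∷ w) = ≤-refl
ones-drop-pred (suc zero) (false ∷ w) = n≤1+n _
ones-drop-pred (suc (suc j)) [] = z≤n
ones-drop-pred (suc (suc j)) (a ∷ w) = ones-drop-pred (suc j) w

ones-suffix-suc : ∀ k (w : Word) → ones (suffix (suc k) w) ≤ suc (ones (suffix k w))
ones-suffix-suc k w
  rewrite sym (pred[m∸n]≡m∸[1+n] (length w) k) = ones-drop-pred (length w ∸ k) w

suffix-length-tail : ∀ (a : Bool) w → suffix (length w) (a ∷ w) ≡ w
suffix-length-tail a w = cong (λ j → drop j (a ∷ w)) (m+n∸n≡m 1 (length w))

length-∷ʳ : ∀ (w : Word) a → length (w ∷ʳ a) ≡ suc (length w)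
length-∷ʳ w a = trans (length-++ w) (+-comm (length w) 1)

take-∷ʳ : ∀ k (w : Word) a → k ≤ length w → take k (w ∷ʳ a) ≡ take k w
take-∷ʳ zero w a _ = refl
take-∷ʳ (suc k) (b ∷ w) a (s≤s k≤) = cong (b ∷_) (take-∷ʳ k w a k≤)

ones-drop-∷ʳ-true : ∀ j (w : Word) → j ≤ length w → ones (drop j (w ∷ʳ true)) ≡ suc (ones (drop j w))
ones-drop-∷ʳ-true zero [] _ = refl
ones-drop-∷ʳ-true zero (true ∷ w) _ = cong suc (ones-drop-∷ʳ-true zero w z≤n)
ones-drop-∷ʳ-true zero (false ∷ w) _ = ones-drop-∷ʳ-true zero w z≤n
ones-drop-∷ʳ-true (suc j) (a ∷ w) (s≤s j≤) = ones-drop-∷ʳ-true j w j≤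

ones-suffix-∷ʳ-true : ∀ k (w : Word) → k ≤ length w →
  ones (suffix (suc k) (w ∷ʳ true)) ≡ suc (ones (suffix k w))
ones-suffix-∷ʳ-true k w k≤ rewrite length-∷ʳ w true =
  ones-drop-∷ʳ-true (length w ∸ k) w (m∸n≤m (length w) k)

take-suc-letter : ∀ j (w : Word) → suc j ≤ length w → take (suc j) w ≡ take j w ∷ʳ letter w (suc j)
take-suc-letter zero (a ∷ w) _ = refl
take-suc-letter (suc j) (a ∷ w) (s≤s j<) = cong (a ∷_) (take-suc-letter j w j<)

searchDown-≤ : ∀ w k → searchDown w k ≤ k
searchDown-≤ w zero = z≤n
searchDown-≤ w (suc k) with ones (prefix (suc k) w) ≟ ones (suffix (suc k) w)
... | yes _ = ≤-refl
... | no _ = m≤n⇒m≤1+n (searchDown-≤ w k)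

searchDown-balanced : ∀ w k →
  ones (prefix (searchDown w k) w) ≡ ones (suffix (searchDown w k) w)
searchDown-balanced w zero rewrite drop-all (length w) w ≤-refl = refl
searchDown-balanced w (suc k) with ones (prefix (suc k) w) ≟ ones (suffix (suc k) w)
... | yes eq = eq
... | no _ = searchDown-balanced w k

searchDown-maximal : ∀ w k j → j ≤ k → ones (prefix j w) ≡ ones (suffix j w) → j ≤ searchDown w k
searchDown-maximal w zero j j≤k _ = j≤k
searchDown-maximal w (suc k) j j≤k eq with ones (prefix (suc k) w) ≟ ones (suffix (suc k) w)
... | yes _ = j≤k
... | no neq with m≤n⇒m<n∨m≡n j≤k
...   | inj₁ (s≤s j≤k′) = searchDown-maximal w k j j≤k′ eq
...   | inj₂ refl = ⊥-elim (neq eq)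

longestAbelianBorder-isAbelianBorder : ∀ a w → IsAbelianBorder (a ∷ w) (longestAbelianBorder (a ∷ w))
longestAbelianBorder-isAbelianBorder a w =
  s≤s (searchDown-≤ (a ∷ w) (length w)) , searchDown-balanced (a ∷ w) (length w)

longestAbelianBorder-maximal : ∀ w ℓ → IsAbelianBorder w ℓ → ℓ ≤ longestAbelianBorder w
longestAbelianBorder-maximal (a ∷ w) ℓ (s≤s ℓ≤∣w∣ , balanced) =
  searchDown-maximal (a ∷ w) (length w) ℓ ℓ≤∣w∣ balanced

longestAbelianBorder-≥ : ∀ w {l m} → l ≤ m → m < length w →
  ones (suffix l w) ≤ ones (prefix l w) → ones (prefix m w) ≤ ones (suffix m w) →
  l ≤ longestAbelianBorder w
longestAbelianBorder-≥ w {l} {m} l≤m m<∣w∣ suffix≤prefix prefix≤suffix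
  with discrete-ivt (λ k → ones (prefix k w)) (λ k → ones (suffix k w))
         (λ k → ones-take-suc k w) (λ k → ones-suffix-suc k w) l≤m suffix≤prefix prefix≤suffix
... | k , l≤k , k≤m , balanced =
  ≤-trans l≤k (longestAbelianBorder-maximal w k (≤-<-trans k≤m m<∣w∣ , balanced))

longestAbelianBorder-∷ʳ-true : ∀ w →
  longestAbelianBorder ((false ∷ w) ∷ʳ true) ≤ longestAbelianBorder (false ∷ w)
longestAbelianBorder-∷ʳ-true w
  with longestAbelianBorder ((false ∷ w) ∷ʳ true)
     | longestAbelianBorder-isAbelianBorder false (w ∷ʳ true)
... | zero | _ = z≤n
... | suc m | ℓ<∣y∣ , balanced = by-cases (m≤n⇒m<n∨m≡n m≤∣w∣)
  where
  z : Word
  z = false ∷ w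
  m≤∣w∣ : m ≤ length w
  m≤∣w∣ = ≤-pred (≤-pred (subst (suc m <_) (length-∷ʳ z true) ℓ<∣y∣))
  one-more : ones (prefix (suc m) z) ≡ suc (ones (suffix m z))
  one-more = begin
    ones (take (suc m) z)               ≡⟨ cong ones (sym (take-∷ʳ (suc m) z true (s≤s m≤∣w∣))) ⟩
    ones (take (suc m) (z ∷ʳ true))     ≡⟨ balanced ⟩
    ones (suffix (suc m) (z ∷ʳ true))   ≡⟨ ones-suffix-∷ʳ-true m z (m≤n⇒m≤1+n m≤∣w∣) ⟩
    suc (ones (suffix m z))             ∎
    where open ≡-Reasoning
  -- ones z and ones w coincide definitionally because z starts with 0.
  prefix≤suffix : ones (prefix (length w) z) ≤ ones (suffix (length w) z)
  prefix≤suffix rewrite suffix-length-tail false w = ones-take≤ones (length w) z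
  by-cases : m < length w ⊎ m ≡ length w → suc m ≤ longestAbelianBorder z
  by-cases (inj₁ m<∣w∣) =
    longestAbelianBorder-≥ z m<∣w∣ (n<1+n (length w))
      (≤-trans (ones-suffix-suc m z) (≤-reflexive (sym one-more))) prefix≤suffix
  by-cases (inj₂ m≡∣w∣) = ⊥-elim (1+n≢n (sym (begin
    ones w                             ≡⟨ cong ones (sym (take-all (suc m) z (s≤s (≤-reflexive (sym m≡∣w∣))))) ⟩
    ones (take (suc m) z)              ≡⟨ one-more ⟩
    suc (ones (suffix m z))            ≡⟨ cong (λ j → suc (ones (suffix j z))) m≡∣w∣ ⟩
    suc (ones (suffix (length w) z))   ≡⟨ cong (λ v → suc (ones v)) (suffix-length-tail false w) ⟩
    suc (ones w)                       ∎)))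
    where open ≡-Reasoning

mainTheorem7 : (x : Word) → letter x 1 ≡ false →
    (i : ℕ) → 1 < i → i ≤ length x → letter x i ≡ true →
    abelianBorderArray x i ≤ abelianBorderArray x (i ∸ 1)
mainTheorem7 (false ∷ x) refl (suc (suc j)) _ (s≤s j<∣x∣) x[i]≡1
  rewrite take-suc-letter j x j<∣x∣ | x[i]≡1 = longestAbelianBorder-∷ʳ-true (take j x)
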